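{- Let $X,Y,Z$ be finite sets, let $f: X \times Y \to Z$ and let $Z_0 \subset Z$. Suppose that there exist $A \subset X$ and $B \subset Y$ such that $f(A \times B) \cap Z_0 = \emptyset$ and $|A|/|X| + |B|/|Y| > 1$. Then there exist subsets $E_n \subset X^n$ and $F_n \subset Y^n$ for every positive integer $n$ such that $f^{\otimes n}(E_n \times F_n) \cap Z_0^n = \emptyset$ and $\min(d(E_n),d(F_n)) \to 1$ as $n \to \infty$.
   Context: $f^{\otimes n}: X^n\times Y^n\to Z^n$ is the coordinatewise map $f^{\otimes n}(x,y)=(f(x_1,y_1),\dots,f(x_n,y_n))$. The density of $E\subset X^n$ is $d(E)=|E|/|X|^n$, and similarly $d(F)=|F|/|Y|^n$ for $F\subset Y^n$. -}

module Defs where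

open import Data.Nat using (ℕ; zero; suc; _^_; NonZero)
open import Data.Nat.Properties using (m^n≢0)
open import Data.Bool using (Bool; true; false)
open import Data.Fin using (Fin)
open import Data.Vec using (Vec; []; _∷_; zipWith)
open import Data.List using (List; []; _∷_; map; concatMap; filterᵇ; length)
open import Data.List.Base using (allFin)
open import Data.Integer using (+_)
open import Data.Rational using (ℚ; _/_)

-- A finite set X of size p is modelled as Fin p; a subset of a finite set T
-- is a Boolean-valued predicate T → Bool (membership: S x ≡ true).

allVecs : (p n : ℕ) → List (Vec (Fin p) n)
allVecs p zero    = [] ∷ []
allVecs p (suc n) = concatMap (λ i → map (i ∷_) (allVecs p n)) (allFin p)

cardVec : {p n : ℕ} → (Vec (Fin p) n → Bool) → ℕ
cardVec {p} {n} E = length (filterᵇ E (allVecs p n))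

cardFin : {p : ℕ} → (Fin p → Bool) → ℕ
cardFin {p} A = length (filterᵇ A (allFin p))

densityVec : {p n : ℕ} → .{{NonZero p}} → (Vec (Fin p) n → Bool) → ℚ
densityVec {p} {n} E = (+ cardVec E) / (p ^ n)
  where instance _ = m^n≢0 p n

densityFin : {p : ℕ} → .{{NonZero p}} → (Fin p → Bool) → ℚ
densityFin {p} A = (+ cardFin A) / p

tensor : {X Y Z : Set} {n : ℕ} → (X → Y → Z) → Vec X n → Vec Y n → Vec Z n
tensor f x y = zipWith f x y

-- Write a = |A|, b = |B| and D = aq + bp − pq, which is positive by the density hypothesis.
-- Let E_n consist of the x with more than n(a/p − D/2pq) coordinates in A, and F_n of the y
-- with more than n(b/q − D/2pq) coordinates in B. For x ∈ E_n and y ∈ F_n these counts add up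
-- to more than n, so some coordinate has x_i ∈ A and y_i ∈ B, and then f(x_i, y_i) ∉ Z₀.
-- The complements are small by Chebyshev's inequality: p·#{i : x_i ∈ A} − na is a sum of n
-- independent centred increments, so its second moment over X^n is at most n p² p^n, and the
-- proportion of atypical x is O(1/n).

module Submission where

open import Defs

open import Algebra.Bundles using (CommutativeSemiring)
open import Data.Bool using (Bool)
open import Data.Fin using (Fin)
open import Data.List using (List; []; _∷_; _++_; map; concatMap; foldr; length; allFin)
open import Data.Nat using (ℕ; suc)
import Data.Nat.Properties as ℕₚ
import Data.Integer.Properties as ℤₚ
open import Data.Vec using (Vec; []; _∷_)
open import Function using (_∘_; id)

module ListSum {c ℓ} (R : CommutativeSemiring c ℓ) where

  open CommutativeSemiring R
  open import Algebra.Properties.CommutativeSemigroup +-commutativeSemigroup using (interchange)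
  open import Relation.Binary.Reasoning.Setoid setoid

  ∑ : {X : Set} → (X → Carrier) → List X → Carrier
  ∑ g = foldr (λ x s → g x + s) 0#

  module _ {X : Set} where

    ∑-cong : {f g : X → Carrier} → (∀ x → f x ≈ g x) → ∀ xs → ∑ f xs ≈ ∑ g xs
    ∑-cong f≈g []       = refl
    ∑-cong f≈g (x ∷ xs) = +-cong (f≈g x) (∑-cong f≈g xs)

    ∑-++ : (g : X → Carrier) (xs ys : List X) → ∑ g (xs ++ ys) ≈ ∑ g xs + ∑ g ys
    ∑-++ g []       ys = sym (+-identityˡ _)
    ∑-++ g (x ∷ xs) ys = trans (+-congˡ (∑-++ g xs ys)) (sym (+-assoc (g x) _ _))

    ∑-+ : (f g : X → Carrier) (xs : List X) → ∑ (λ x → f x + g x) xs ≈ ∑ f xs + ∑ g xs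
    ∑-+ f g []       = sym (+-identityˡ 0#)
    ∑-+ f g (x ∷ xs) = trans (+-congˡ (∑-+ f g xs)) (interchange (f x) (g x) _ _)

    ∑-*ˡ : (a : Carrier) (g : X → Carrier) (xs : List X) → ∑ (λ x → a * g x) xs ≈ a * ∑ g xs
    ∑-*ˡ a g []       = sym (zeroʳ a)
    ∑-*ˡ a g (x ∷ xs) = trans (+-congˡ (∑-*ˡ a g xs)) (sym (distribˡ a (g x) _))

  module _ {X Y : Set} where

    ∑-map : (g : Y → Carrier) (h : X → Y) (xs : List X) → ∑ g (map h xs) ≈ ∑ (g ∘ h) xs
    ∑-map g h []       = refl
    ∑-map g h (x ∷ xs) = +-congˡ (∑-map g h xs)

    ∑-concatMap : (g : Y → Carrier) (h : X → List Y) (xs : List X) →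
                  ∑ g (concatMap h xs) ≈ ∑ (λ x → ∑ g (h x)) xs
    ∑-concatMap g h []       = refl
    ∑-concatMap g h (x ∷ xs) = begin
      ∑ g (h x ++ concatMap h xs)        ≈⟨ ∑-++ g (h x) (concatMap h xs) ⟩
      ∑ g (h x) + ∑ g (concatMap h xs)   ≈⟨ +-congˡ (∑-concatMap g h xs) ⟩
      ∑ g (h x) + ∑ (λ x → ∑ g (h x)) xs ∎

  ∑-allVecs-suc : ∀ {p} {n : ℕ} (g : Vec (Fin p) (suc n) → Carrier) →
                  ∑ g (allVecs p (suc n)) ≈ ∑ (λ i → ∑ (g ∘ (i ∷_)) (allVecs p n)) (allFin p)
  ∑-allVecs-suc {p} {n} g = begin
    ∑ g (concatMap (λ i → map (i ∷_) (allVecs p n)) (allFin p))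
      ≈⟨ ∑-concatMap g (λ i → map (i ∷_) (allVecs p n)) (allFin p) ⟩
    ∑ (λ i → ∑ g (map (i ∷_) (allVecs p n))) (allFin p)
      ≈⟨ ∑-cong (λ i → ∑-map g (i ∷_) (allVecs p n)) (allFin p) ⟩
    ∑ (λ i → ∑ (g ∘ (i ∷_)) (allVecs p n)) (allFin p) ∎

module Counting where

  open import Data.Bool using (true; false; if_then_else_)
  open import Data.Integer using (ℤ; +_) renaming (_+_ to _+ℤ_; _*_ to _*ℤ_)
  open import Data.List using (filterᵇ)
  open import Data.List.Properties using (length-tabulate; length-filter)
  open import Data.Nat
  open import Data.Vec using (countᵇ)
  open import Relation.Binary.PropositionalEquality
  open import Relation.Nullary.Decidable using (T?)

  module ℕ-sum = ListSum ℕₚ.+-*-commutativeSemiring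
  module ℤ-sum = ListSum ℤₚ.+-*-commutativeSemiring
  open ℕ-sum public using () renaming (∑ to ∑ℕ)
  open ℤ-sum public using () renaming (∑ to ∑ℤ)

  module _ {X : Set} where

    ∑ℕ-const : (a : ℕ) (xs : List X) → ∑ℕ (λ _ → a) xs ≡ length xs * a
    ∑ℕ-const a []       = refl
    ∑ℕ-const a (x ∷ xs) = cong (_+_ a) (∑ℕ-const a xs)

    ∑ℤ-const : (a : ℤ) (xs : List X) → ∑ℤ (λ _ → a) xs ≡ + length xs *ℤ a
    ∑ℤ-const a []       = sym (ℤₚ.*-zeroˡ a)
    ∑ℤ-const a (x ∷ xs) = trans (cong (a +ℤ_) (∑ℤ-const a xs)) (sym (ℤₚ.suc-* (+ length xs) a))

    ∑ℕ-mono-≤ : {f g : X → ℕ} → (∀ x → f x ≤ g x) → ∀ xs → ∑ℕ f xs ≤ ∑ℕ g xs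
    ∑ℕ-mono-≤ f≤g []       = z≤n
    ∑ℕ-mono-≤ f≤g (x ∷ xs) = ℕₚ.+-mono-≤ (f≤g x) (∑ℕ-mono-≤ f≤g xs)

    pos-∑ : (g : X → ℕ) (xs : List X) → + ∑ℕ g xs ≡ ∑ℤ (+_ ∘ g) xs
    pos-∑ g []       = refl
    pos-∑ g (x ∷ xs) = trans (ℤₚ.pos-+ (g x) _) (cong (+ g x +ℤ_) (pos-∑ g xs))

  χ : Bool → ℕ
  χ b = if b then 1 else 0

  length-filterᵇ : {X : Set} (P : X → Bool) (xs : List X) → length (filterᵇ P xs) ≡ ∑ℕ (χ ∘ P) xs
  length-filterᵇ P []       = refl
  length-filterᵇ P (x ∷ xs) with P x
  ... | true  = cong suc (length-filterᵇ P xs)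
  ... | false = length-filterᵇ P xs

  countᵇ-∷ : ∀ {p n} (A : Fin p → Bool) (i : Fin p) (x : Vec (Fin p) n) →
             countᵇ A (i ∷ x) ≡ χ (A i) + countᵇ A x
  countᵇ-∷ A i x with A i
  ... | true  = refl
  ... | false = refl

  length-allVecs : ∀ p n → length (allVecs p n) ≡ p ^ n
  length-allVecs p zero    = refl
  length-allVecs p (suc n) = begin
    length (allVecs p (suc n))                         ≡⟨ length≡∑1 (allVecs p (suc n)) ⟩
    ∑ℕ (λ _ → 1) (allVecs p (suc n))                   ≡⟨ ℕ-sum.∑-allVecs-suc {p} {n} (λ _ → 1) ⟩
    ∑ℕ (λ _ → ∑ℕ (λ _ → 1) (allVecs p n)) (allFin p)   ≡⟨ cong (λ m → ∑ℕ (λ _ → m) (allFin p)) IH ⟩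
    ∑ℕ (λ _ → p ^ n) (allFin p)                        ≡⟨ ∑ℕ-const (p ^ n) (allFin p) ⟩
    length (allFin p) * p ^ n                          ≡⟨ cong (_* p ^ n) (length-tabulate {n = p} id) ⟩
    p * p ^ n                                          ∎
    where
    open ≡-Reasoning
    length≡∑1 : {X : Set} (xs : List X) → length xs ≡ ∑ℕ (λ _ → 1) xs
    length≡∑1 xs = sym (trans (∑ℕ-const 1 xs) (ℕₚ.*-identityʳ (length xs)))
    IH : ∑ℕ (λ _ → 1) (allVecs p n) ≡ p ^ n
    IH = trans (sym (length≡∑1 (allVecs p n))) (length-allVecs p n)

  cardFin≤ : ∀ {p} (A : Fin p → Bool) → cardFin A ≤ p
  cardFin≤ {p} A = ℕₚ.≤-trans (length-filter (T? ∘ A) (allFin p)) (ℕₚ.≤-reflexive (length-tabulate id))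

  cardVec≤ : ∀ {p n} (E : Vec (Fin p) n → Bool) → cardVec E ≤ p ^ n
  cardVec≤ {p} {n} E = ℕₚ.≤-trans (length-filter (T? ∘ E) (allVecs p n)) (ℕₚ.≤-reflexive (length-allVecs p n))

  markov : {X : Set} (P : X → Bool) (g : X → ℕ) (T : ℕ) → (∀ x → P x ≡ false → T ≤ g x) →
           ∀ xs → T * length xs ≤ T * length (filterᵇ P xs) + ∑ℕ g xs
  markov P g T T≤g xs = begin
    T * length xs                         ≡⟨ ℕₚ.*-comm T (length xs) ⟩
    length xs * T                         ≡⟨ ∑ℕ-const T xs ⟨
    ∑ℕ (λ _ → T) xs                       ≤⟨ ∑ℕ-mono-≤ T≤Tχ+g xs ⟩
    ∑ℕ (λ x → T * χ (P x) + g x) xs       ≡⟨ ℕ-sum.∑-+ (λ x → T * χ (P x)) g xs ⟩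
    ∑ℕ (λ x → T * χ (P x)) xs + ∑ℕ g xs   ≡⟨ cong (_+ ∑ℕ g xs) (ℕ-sum.∑-*ˡ T (χ ∘ P) xs) ⟩
    T * ∑ℕ (χ ∘ P) xs + ∑ℕ g xs           ≡⟨ cong (λ k → T * k + ∑ℕ g xs) (length-filterᵇ P xs) ⟨
    T * length (filterᵇ P xs) + ∑ℕ g xs   ∎
    where
    open ℕₚ.≤-Reasoning
    T≤Tχ+g : ∀ x → T ≤ T * χ (P x) + g x
    T≤Tχ+g x with P x in Px
    ... | true  = ℕₚ.≤-trans (ℕₚ.≤-reflexive (sym (ℕₚ.*-identityʳ T))) (ℕₚ.m≤m+n (T * 1) (g x))
    ... | false = ℕₚ.≤-trans (T≤g x Px) (ℕₚ.≤-reflexive (cong (_+ g x) (sym (ℕₚ.*-zeroʳ T))))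

module IntegerSums where

  open import Data.Integer using (ℤ; +_; -[1+_]; 0ℤ; _+_; _*_; ∣_∣; _⊖_)
  open import Data.Integer.Tactic.RingSolver using (solve-∀)
  import Data.Nat as ℕ
  open import Data.Sum using (inj₁; inj₂)
  open import Relation.Binary.PropositionalEquality
  open Counting

  ∸≤∣⊖∣ : ∀ m n → n ℕ.∸ m ℕ.≤ ∣ m ⊖ n ∣
  ∸≤∣⊖∣ m n with ℕₚ.≤-total m n
  ... | inj₁ m≤n = ℕₚ.≤-reflexive (sym (ℤₚ.∣⊖∣-≤ m≤n))
  ... | inj₂ n≤m = ℕₚ.≤-trans (ℕₚ.≤-reflexive (ℕₚ.m≤n⇒m∸n≡0 n≤m)) ℕ.z≤n

  +∣i∣*∣i∣≡i*i : ∀ i → + (∣ i ∣ ℕ.* ∣ i ∣) ≡ i * i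
  +∣i∣*∣i∣≡i*i (+ n)      = sym (ℤₚ.+◃n≡+n (n ℕ.* n))
  +∣i∣*∣i∣≡i*i -[1+ n ] = sym (ℤₚ.+◃n≡+n _)

  pos-∑-square : {X : Set} (g : X → ℤ) (xs : List X) →
                 + ∑ℕ (λ x → ∣ g x ∣ ℕ.* ∣ g x ∣) xs ≡ ∑ℤ (λ x → g x * g x) xs
  pos-∑-square g xs = trans (pos-∑ _ xs) (ℤ-sum.∑-cong (+∣i∣*∣i∣≡i*i ∘ g) xs)

  ∑∑-square-+-centred : ∀ {X I : Set} (f : X → ℤ) (g : I → ℤ) (xs : List X) (is : List I) →
    ∑ℤ g is ≡ 0ℤ →
    ∑ℤ (λ i → ∑ℤ (λ x → (f x + g i) * (f x + g i)) xs) is ≡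
      + length is * ∑ℤ (λ x → f x * f x) xs + + length xs * ∑ℤ (λ i → g i * g i) is
  ∑∑-square-+-centred f g xs is ∑g≡t²moment0 = begin
    ∑ℤ (λ i → ∑ℤ (λ x → (f x + g i) * (f x + g i)) xs) is
      ≡⟨ ℤ-sum.∑-cong inner is ⟩
    ∑ℤ (λ i → F₂ + + 2 * F₁ * g i + + length xs * (g i * g i)) is
      ≡⟨ ℤ-sum.∑-+ (λ i → F₂ + + 2 * F₁ * g i) (λ i → + length xs * (g i * g i)) is ⟩
    ∑ℤ (λ i → F₂ + + 2 * F₁ * g i) is + ∑ℤ (λ i → + length xs * (g i * g i)) is
      ≡⟨ cong₂ _+_ (ℤ-sum.∑-+ (λ _ → F₂) (λ i → + 2 * F₁ * g i) is)
                   (ℤ-sum.∑-*ˡ (+ length xs) (λ i → g i * g i) is) ⟩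
    ∑ℤ (λ _ → F₂) is + ∑ℤ (λ i → + 2 * F₁ * g i) is + + length xs * ∑ℤ (λ i → g i * g i) is
      ≡⟨ cong₂ (λ s t → s + t + + length xs * ∑ℤ (λ i → g i * g i) is)
               (∑ℤ-const F₂ is)
               (trans (ℤ-sum.∑-*ˡ (+ 2 * F₁) g is) (cong (+ 2 * F₁ *_) ∑g≡t²moment0)) ⟩
    + length is * F₂ + + 2 * F₁ * 0ℤ + + length xs * ∑ℤ (λ i → g i * g i) is
      ≡⟨ cong (_+ + length xs * ∑ℤ (λ i → g i * g i) is) (drop-0 (+ length is) F₂ F₁) ⟩
    + length is * F₂ + + length xs * ∑ℤ (λ i → g i * g i) is
      ∎
    where
    open ≡-Reasoning
    F₁ = ∑ℤ f xs
    F₂ = ∑ℤ (λ x → f x * f x) xs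
    square-+ : ∀ u w → (u + w) * (u + w) ≡ u * u + + 2 * w * u + w * w
    square-+ = solve-∀
    swap : ∀ w u → + 2 * w * u ≡ + 2 * u * w
    swap = solve-∀
    drop-0 : ∀ l u w → l * u + + 2 * w * 0ℤ ≡ l * u
    drop-0 = solve-∀
    inner : ∀ i → ∑ℤ (λ x → (f x + g i) * (f x + g i)) xs ≡ F₂ + + 2 * F₁ * g i + + length xs * (g i * g i)
    inner i = begin
      ∑ℤ (λ x → (f x + g i) * (f x + g i)) xs
        ≡⟨ ℤ-sum.∑-cong (λ x → square-+ (f x) (g i)) xs ⟩
      ∑ℤ (λ x → f x * f x + + 2 * g i * f x + g i * g i) xs
        ≡⟨ ℤ-sum.∑-+ (λ x → f x * f x + + 2 * g i * f x) (λ _ → g i * g i) xs ⟩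
      ∑ℤ (λ x → f x * f x + + 2 * g i * f x) xs + ∑ℤ (λ _ → g i * g i) xs
        ≡⟨ cong₂ _+_ (ℤ-sum.∑-+ (λ x → f x * f x) (λ x → + 2 * g i * f x) xs) (∑ℤ-const (g i * g i) xs) ⟩
      F₂ + ∑ℤ (λ x → + 2 * g i * f x) xs + + length xs * (g i * g i)
        ≡⟨ cong (λ s → F₂ + s + + length xs * (g i * g i)) (ℤ-sum.∑-*ˡ (+ 2 * g i) f xs) ⟩
      F₂ + + 2 * g i * F₁ + + length xs * (g i * g i)
        ≡⟨ cong (λ s → F₂ + s + + length xs * (g i * g i)) (swap (g i) F₁) ⟩
      F₂ + + 2 * F₁ * g i + + length xs * (g i * g i)
        ∎

module Deviation {p : ℕ} (A : Fin p → Bool) where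

  open import Data.List.Properties using (length-tabulate)
  open import Data.Integer using (ℤ; +_; 0ℤ; _+_; _-_; -_; _*_; ∣_∣; -[1+_])
  open import Data.Integer.Tactic.RingSolver using (solve-∀)
  import Data.Nat as ℕ
  open import Data.Vec using (countᵇ)
  open import Relation.Binary.PropositionalEquality
  open Counting
  open IntegerSums

  a : ℕ
  a = cardFin A

  deviation : ∀ n → Vec (Fin p) n → ℤ
  deviation n x = + (p ℕ.* countᵇ A x) - + (n ℕ.* a)

  increment : Fin p → ℤ
  increment i = + (p ℕ.* χ (A i)) - + a

  deviation-∷ : ∀ {n} i (x : Vec (Fin p) n) → deviation (suc n) (i ∷ x) ≡ deviation n x + increment i
  deviation-∷ {n} i x = begin
    + (p ℕ.* countᵇ A (i ∷ x)) - + (a ℕ.+ n ℕ.* a)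
      ≡⟨ cong (λ k → + (p ℕ.* k) - + (a ℕ.+ n ℕ.* a)) (countᵇ-∷ A i x) ⟩
    + (p ℕ.* (χ (A i) ℕ.+ countᵇ A x)) - + (a ℕ.+ n ℕ.* a)
      ≡⟨ cong₂ _-_ (trans (cong +_ (ℕₚ.*-distribˡ-+ p (χ (A i)) (countᵇ A x)))
                          (ℤₚ.pos-+ (p ℕ.* χ (A i)) (p ℕ.* countᵇ A x)))
                   (ℤₚ.pos-+ a (n ℕ.* a)) ⟩
    (+ (p ℕ.* χ (A i)) + + (p ℕ.* countᵇ A x)) - (+ a + + (n ℕ.* a))
      ≡⟨ regroup (+ (p ℕ.* χ (A i))) (+ (p ℕ.* countᵇ A x)) (+ a) (+ (n ℕ.* a)) ⟩
    deviation n x + increment i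
      ∎
    where
    open ≡-Reasoning
    regroup : ∀ u v w z → (u + v) - (w + z) ≡ (v - z) + (u - w)
    regroup = solve-∀

  ∑-increment≡0 : ∑ℤ increment (allFin p) ≡ 0ℤ
  ∑-increment≡0 = begin
    ∑ℤ (λ i → + (p ℕ.* χ (A i)) + - + a) (allFin p)
      ≡⟨ ℤ-sum.∑-+ (λ i → + (p ℕ.* χ (A i))) (λ _ → - + a) (allFin p) ⟩
    ∑ℤ (λ i → + (p ℕ.* χ (A i))) (allFin p) + ∑ℤ (λ _ → - + a) (allFin p)
      ≡⟨ cong₂ _+_ (sym (pos-∑ (λ i → p ℕ.* χ (A i)) (allFin p))) (∑ℤ-const (- + a) (allFin p)) ⟩
    + ∑ℕ (λ i → p ℕ.* χ (A i)) (allFin p) + + length (allFin p) * - + a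
      ≡⟨ cong₂ (λ s l → + s + + l * - + a)
               (trans (ℕ-sum.∑-*ˡ p (χ ∘ A) (allFin p)) (cong (p ℕ.*_) (sym (length-filterᵇ A (allFin p)))))
               (length-tabulate {n = p} id) ⟩
    + (p ℕ.* a) + + p * - + a
      ≡⟨ cong (_+ + p * - + a) (ℤₚ.pos-* p a) ⟩
    + p * + a + + p * - + a
      ≡⟨ cancel (+ p) (+ a) ⟩
    0ℤ
      ∎
    where
    open ≡-Reasoning
    cancel : ∀ u v → u * v + u * - v ≡ 0ℤ
    cancel = solve-∀

  -- Kept in ℕ through ∣_∣ so that Markov's inequality can be applied in ℕ.
  moment : ℕ → ℕ
  moment n = ∑ℕ (λ x → ∣ deviation n x ∣ ℕ.* ∣ deviation n x ∣) (allVecs p n)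

  incrementMoment : ℕ
  incrementMoment = ∑ℕ (λ i → ∣ increment i ∣ ℕ.* ∣ increment i ∣) (allFin p)

  moment-suc : ∀ n → moment (suc n) ≡ p ℕ.* moment n ℕ.+ p ℕ.^ n ℕ.* incrementMoment
  moment-suc n = ℤₚ.+-injective (begin
    + moment (suc n)
      ≡⟨ pos-∑-square (deviation (suc n)) (allVecs p (suc n)) ⟩
    ∑ℤ (λ x → deviation (suc n) x * deviation (suc n) x) (allVecs p (suc n))
      ≡⟨ ℤ-sum.∑-allVecs-suc {p} {n} (λ x → deviation (suc n) x * deviation (suc n) x) ⟩
    ∑ℤ (λ i → ∑ℤ (λ x → deviation (suc n) (i ∷ x) * deviation (suc n) (i ∷ x)) (allVecs p n)) (allFin p)
      ≡⟨ ℤ-sum.∑-cong (λ i → ℤ-sum.∑-cong (λ x → cong (λ d → d * d) (deviation-∷ i x)) (allVecs p n)) (allFin p) ⟩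
    ∑ℤ (λ i → ∑ℤ (λ x → (deviation n x + increment i) * (deviation n x + increment i)) (allVecs p n)) (allFin p)
      ≡⟨ ∑∑-square-+-centred (deviation n) increment (allVecs p n) (allFin p) ∑-increment≡0 ⟩
    + length (allFin p) * D₂ + + length (allVecs p n) * I₂
      ≡⟨ cong₂ (λ k l → + k * D₂ + + l * I₂) (length-tabulate {n = p} id) (length-allVecs p n) ⟩
    + p * D₂ + + (p ℕ.^ n) * I₂
      ≡⟨ cong₂ (λ d i → + p * d + + (p ℕ.^ n) * i)
               (sym (pos-∑-square (deviation n) (allVecs p n))) (sym (pos-∑-square increment (allFin p))) ⟩
    + p * + moment n + + (p ℕ.^ n) * + incrementMoment
      ≡⟨ cong₂ _+_ (ℤₚ.pos-* p (moment n)) (ℤₚ.pos-* (p ℕ.^ n) incrementMoment) ⟨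
    + (p ℕ.* moment n) + + (p ℕ.^ n ℕ.* incrementMoment)
      ≡⟨ ℤₚ.pos-+ (p ℕ.* moment n) (p ℕ.^ n ℕ.* incrementMoment) ⟨
    + (p ℕ.* moment n ℕ.+ p ℕ.^ n ℕ.* incrementMoment)
      ∎)
    where
    open ≡-Reasoning
    D₂ = ∑ℤ (λ x → deviation n x * deviation n x) (allVecs p n)
    I₂ = ∑ℤ (λ i → increment i * increment i) (allFin p)

module DeviationBounds {p : ℕ} (A : Fin p → Bool) where

  open import Data.Bool using (true; false)
  open import Data.Integer as ℤ using (∣_∣)
  open import Data.List.Properties using (length-tabulate)
  open import Data.Nat
  open import Data.Nat.Tactic.RingSolver using (solve-∀)
  open import Relation.Binary.PropositionalEquality
  open Counting
  open Deviation A

  ∣increment∣≤ : ∀ i → ∣ increment i ∣ ≤ p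
  ∣increment∣≤ i = begin
    ∣ increment i ∣              ≡⟨ cong ∣_∣ (ℤₚ.m-n≡m⊖n (p * χ (A i)) a) ⟩
    ∣ p * χ (A i) ℤ.⊖ a ∣        ≤⟨ ℤₚ.∣m⊝n∣≤m⊔n (p * χ (A i)) a ⟩
    p * χ (A i) ⊔ a              ≤⟨ ℕₚ.⊔-lub (p*χ≤p (A i)) (cardFin≤ A) ⟩
    p                            ∎
    where
    open ℕₚ.≤-Reasoning
    p*χ≤p : ∀ b → p * χ b ≤ p
    p*χ≤p true  = ℕₚ.≤-reflexive (ℕₚ.*-identityʳ p)
    p*χ≤p false = ℕₚ.≤-trans (ℕₚ.≤-reflexive (ℕₚ.*-zeroʳ p)) z≤n

  incrementMoment≤ : incrementMoment ≤ p * (p * p)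
  incrementMoment≤ = begin
    incrementMoment               ≤⟨ ∑ℕ-mono-≤ (λ i → ℕₚ.*-mono-≤ (∣increment∣≤ i) (∣increment∣≤ i)) (allFin p) ⟩
    ∑ℕ (λ _ → p * p) (allFin p)   ≡⟨ ∑ℕ-const (p * p) (allFin p) ⟩
    length (allFin p) * (p * p)   ≡⟨ cong (_* (p * p)) (length-tabulate {n = p} id) ⟩
    p * (p * p)                   ∎
    where open ℕₚ.≤-Reasoning

  moment≤ : ∀ n → moment n ≤ n * (p * p) * p ^ n
  moment≤ zero    rewrite ℕₚ.*-zeroʳ p = z≤n
  moment≤ (suc n) = begin
    moment (suc n)                                 ≡⟨ moment-suc n ⟩
    p * moment n + p ^ n * incrementMoment         ≤⟨ ℕₚ.+-mono-≤ (ℕₚ.*-monoʳ-≤ p (moment≤ n))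
                                                                   (ℕₚ.*-monoʳ-≤ (p ^ n) incrementMoment≤) ⟩
    p * (n * (p * p) * p ^ n) + p ^ n * (p * (p * p)) ≡⟨ regroup n p (p ^ n) ⟩
    suc n * (p * p) * (p * p ^ n)                  ∎
    where
    open ℕₚ.≤-Reasoning
    regroup : ∀ n p P → p * (n * (p * p) * P) + P * (p * (p * p)) ≡ suc n * (p * p) * (p * P)
    regroup = solve-∀

module Deficit where

  open import Data.Nat
  open import Data.Nat.Tactic.RingSolver using (solve-∀)
  open import Relation.Binary.PropositionalEquality

  deficit*k< : ∀ P c n D C k .{{_ : NonZero P}} .{{_ : NonZero D}} →
    (P ∸ c) * (n * (D * D)) ≤ C * P → C * k < n → (P ∸ c) * k < P
  deficit*k< P c n D C k deficit≤ Ck<n = ℕₚ.*-cancelʳ-< n ((P ∸ c) * k) P (begin-strict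
    (P ∸ c) * k * n                ≤⟨ ℕₚ.*-monoʳ-≤ ((P ∸ c) * k) (ℕₚ.m≤m*n n (D * D) {{ℕₚ.m*n≢0 D D}}) ⟩
    (P ∸ c) * k * (n * (D * D))    ≡⟨ swap (P ∸ c) k (n * (D * D)) ⟩
    k * ((P ∸ c) * (n * (D * D)))  ≤⟨ ℕₚ.*-monoʳ-≤ k deficit≤ ⟩
    k * (C * P)                    ≡⟨ ℕₚ.*-assoc k C P ⟨
    k * C * P                      ≡⟨ cong (_* P) (ℕₚ.*-comm k C) ⟩
    C * k * P                      <⟨ ℕₚ.*-monoˡ-< P Ck<n ⟩
    n * P                          ≡⟨ ℕₚ.*-comm n P ⟩
    P * n                          ∎)
    where
    open ℕₚ.≤-Reasoning
    swap : ∀ δ k X → δ * k * X ≡ k * (δ * X)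
    swap = solve-∀

module RationalBounds where

  open import Data.Integer as ℤ using (+_)
  open import Data.Integer.Tactic.RingSolver using (solve-∀)
  open import Data.Nat as ℕ using (NonZero; _∸_; _≤_; _<_)
  open import Data.Empty using (⊥-elim)
  open import Data.Rational as ℚ using (ℚ; mkℚ; 1ℚ; _/_)
  import Data.Rational.Properties as ℚₚ
  open import Data.Rational.Unnormalised as ℚᵘ using (mkℚᵘ; _≃_; *<*; *≡*)
  import Data.Rational.Unnormalised.Properties as ℚᵘₚ
  open import Data.Sum using (inj₁; inj₂)
  open import Relation.Binary.PropositionalEquality

  toℚᵘ-/ : ∀ a k → ℚ.toℚᵘ (+ a / suc k) ≃ mkℚᵘ (+ a) k
  toℚᵘ-/ a k = ℚₚ.toℚᵘ-fromℚᵘ (mkℚᵘ (+ a) k)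

  1<a/p+b/q⇒pq<aq+bp : ∀ p q a b .{{_ : NonZero p}} .{{_ : NonZero q}} →
    1ℚ ℚ.< + a / p ℚ.+ + b / q → p ℕ.* q < a ℕ.* q ℕ.+ b ℕ.* p
  1<a/p+b/q⇒pq<aq+bp (suc k) (suc l) a b 1<a/p+b/q =
    ℤₚ.drop‿+<+ (subst₂ ℤ._<_ (ℤₚ.*-identityˡ _) aq+bp≡
      (ℚᵘₚ.drop-*<* (ℚᵘₚ.<-respʳ-≃ toℚᵘ-sum (ℚₚ.toℚᵘ-mono-< 1<a/p+b/q))))
    where
    toℚᵘ-sum : ℚ.toℚᵘ (+ a / suc k ℚ.+ + b / suc l) ≃ mkℚᵘ (+ a) k ℚᵘ.+ mkℚᵘ (+ b) l
    toℚᵘ-sum = ℚᵘₚ.≃-trans (ℚₚ.toℚᵘ-homo-+ (+ a / suc k) (+ b / suc l))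
                           (ℚᵘₚ.+-cong (toℚᵘ-/ a k) (toℚᵘ-/ b l))
    aq+bp≡ : (+ a ℤ.* + suc l ℤ.+ + b ℤ.* + suc k) ℤ.* + 1 ≡ + (a ℕ.* suc l ℕ.+ b ℕ.* suc k)
    aq+bp≡ = trans (ℤₚ.*-identityʳ _)
      (sym (trans (ℤₚ.pos-+ (a ℕ.* suc l) (b ℕ.* suc k)) (cong₂ ℤ._+_ (ℤₚ.pos-* a (suc l)) (ℤₚ.pos-* b (suc k)))))

  -- ε ≥ 1/↧ₙ ε, so it suffices that (P − c)/P < 1/↧ₙ ε.
  ∣1-c/P∣<ε : ∀ c P .{{_ : NonZero P}} → c ≤ P → (ε : ℚ) → ℚ.0ℚ ℚ.< ε →
    (P ∸ c) ℕ.* ℚ.↧ₙ ε < P → ℚ.∣ 1ℚ ℚ.- + c / P ∣ ℚ.< ε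
  ∣1-c/P∣<ε c P c≤P ε@(mkℚ ℤ.+0 _ _)       0<ε = ⊥-elim (ℤ.Positive.pos (ℚ.positive 0<ε))
  ∣1-c/P∣<ε c P c≤P ε@(mkℚ ℤ.-[1+ _ ] _ _) 0<ε = ⊥-elim (ℤ.Positive.pos (ℚ.positive 0<ε))
  ∣1-c/P∣<ε c (suc k) c≤P ε@(mkℚ ℤ.+[1+ e ] d _) _ deficit*d<P =
    subst (ℚ._< ε) (sym (ℚₚ.0≤p⇒∣p∣≡p 0≤1-c/P)) 1-c/P<ε
    where
    m = suc k ∸ c
    +m≡P-c : + m ≡ + suc k ℤ.- + c
    +m≡P-c = trans (sym (ℤₚ.⊖-≥ c≤P)) (sym (ℤₚ.m-n≡m⊖n (suc k) c))
    regroup : ∀ P c → (+ 1 ℤ.* P ℤ.+ (ℤ.- c) ℤ.* + 1) ℤ.* P ≡ (P ℤ.- c) ℤ.* (+ 1 ℤ.* P)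
    regroup = solve-∀
    1-c/P≃m/P : ℚ.toℚᵘ (1ℚ ℚ.- + c / suc k) ≃ mkℚᵘ (+ m) k
    1-c/P≃m/P = ℚᵘₚ.≃-trans (ℚₚ.toℚᵘ-homo-+ 1ℚ (ℚ.- (+ c / suc k)))
      (ℚᵘₚ.≃-trans (ℚᵘₚ.+-cong (ℚᵘₚ.≃-refl {ℚ.toℚᵘ 1ℚ})
                               (ℚᵘₚ.≃-trans (ℚₚ.toℚᵘ-homo‿- (+ c / suc k)) (ℚᵘₚ.-‿cong (toℚᵘ-/ c k))))
                   (*≡* (trans (regroup (+ suc k) (+ c)) (cong (ℤ._* (+ 1 ℤ.* + suc k)) (sym +m≡P-c)))))
    0≤1-c/P : ℚ.0ℚ ℚ.≤ 1ℚ ℚ.- + c / suc k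
    0≤1-c/P = ℚₚ.toℚᵘ-cancel-≤
      (ℚᵘₚ.≤-respʳ-≃ (ℚᵘₚ.≃-sym 1-c/P≃m/P) (ℚᵘₚ.nonNegative⁻¹ (mkℚᵘ (+ m) k)))
    md<[1+e]P : m ℕ.* suc d < suc e ℕ.* suc k
    md<[1+e]P = ℕₚ.<-≤-trans deficit*d<P (ℕₚ.m≤n*m (suc k) (suc e))
    1-c/P<ε : 1ℚ ℚ.- + c / suc k ℚ.< ε
    1-c/P<ε = ℚₚ.toℚᵘ-cancel-< (ℚᵘₚ.<-respˡ-≃ (ℚᵘₚ.≃-sym 1-c/P≃m/P)
      (*<* (subst₂ ℤ._<_ (sym (ℤₚ.+◃n≡+n (m ℕ.* suc d))) (sym (ℤₚ.+◃n≡+n (suc e ℕ.* suc k)))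
                         (ℤ.+<+ md<[1+e]P))))

  ∣1-x⊓y∣<ε : ∀ (x y ε : ℚ) → ℚ.∣ 1ℚ ℚ.- x ∣ ℚ.< ε → ℚ.∣ 1ℚ ℚ.- y ∣ ℚ.< ε →
              ℚ.∣ 1ℚ ℚ.- (x ℚ.⊓ y) ∣ ℚ.< ε
  ∣1-x⊓y∣<ε x y ε ∣1-x∣<ε ∣1-y∣<ε with ℚₚ.≤-total x y
  ... | inj₁ x≤y rewrite ℚₚ.p≤q⇒p⊓q≡p x≤y = ∣1-x∣<ε
  ... | inj₂ y≤x rewrite ℚₚ.p≥q⇒p⊓q≡q y≤x = ∣1-y∣<ε

module Typical {p : ℕ} (A : Fin p → Bool) (t D : ℕ) where

  open import Data.Bool using (true; false)
  open import Data.Integer as ℤ using (∣_∣)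
  open import Data.Nat
  open import Data.Nat.Tactic.RingSolver using (solve-∀)
  open import Data.Vec using (countᵇ)
  open import Relation.Nullary using (¬_; does; proof; Reflects; invert)
  open import Relation.Binary.PropositionalEquality
  open Counting
  open IntegerSums using (∸≤∣⊖∣)
  open Deficit
  open Deviation A
  open DeviationBounds A
  open RationalBounds
  import Data.Rational as ℚ

  -- p·#A(x) − na > −nD/t, with denominators cleared
  typical : (n : ℕ) → Vec (Fin p) n → Bool
  typical n x = does (t * (n * a) <? t * (p * countᵇ A x) + n * D)

  typical⇒ : ∀ {n} (x : Vec (Fin p) n) → typical n x ≡ true → t * (n * a) < t * (p * countᵇ A x) + n * D
  typical⇒ {n} x typ = invert (subst (Reflects _) typ (proof (t * (n * a) <? t * (p * countᵇ A x) + n * D)))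

  nD≤t∣deviation∣ : ∀ {n} (x : Vec (Fin p) n) → typical n x ≡ false → n * D ≤ t * ∣ deviation n x ∣
  nD≤t∣deviation∣ {n} x atypical = begin
    n * D                                 ≡⟨ ℕₚ.m+n∸m≡n (t * K) (n * D) ⟨
    t * K + n * D ∸ t * K                 ≤⟨ ℕₚ.∸-monoˡ-≤ (t * K) (ℕₚ.≮⇒≥ ≮) ⟩
    t * (n * a) ∸ t * K                   ≡⟨ ℕₚ.*-distribˡ-∸ t (n * a) K ⟨
    t * (n * a ∸ K)                       ≤⟨ ℕₚ.*-monoʳ-≤ t (∸≤∣⊖∣ K (n * a)) ⟩
    t * ∣ K ℤ.⊖ n * a ∣                   ≡⟨ cong (λ z → t * ∣ z ∣) (ℤₚ.m-n≡m⊖n K (n * a)) ⟨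
    t * ∣ deviation n x ∣                 ∎
    where
    open ℕₚ.≤-Reasoning
    K = p * countᵇ A x
    ≮ : ¬ t * (n * a) < t * K + n * D
    ≮ = invert (subst (Reflects _) atypical (proof (t * (n * a) <? t * K + n * D)))

  atypical-deficit : ∀ n .{{_ : NonZero n}} → (p ^ n ∸ cardVec (typical n)) * (n * (D * D)) ≤ t * t * (p * p) * p ^ n
  atypical-deficit n = ℕₚ.*-cancelˡ-≤ n (begin
    n * ((P ∸ c) * (n * (D * D)))  ≡⟨ factor-n n (P ∸ c) D ⟩
    (P ∸ c) * T                    ≡⟨ ℕₚ.*-distribʳ-∸ T P c ⟩
    P * T ∸ c * T                  ≤⟨ ℕₚ.m≤n+o⇒m∸n≤o (P * T) (c * T) markov-bound ⟩
    t * t * (n * (p * p) * P)      ≡⟨ factor-n′ n t p P ⟩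
    n * (t * t * (p * p) * P)      ∎)
    where
    open ℕₚ.≤-Reasoning
    P = p ^ n
    c = cardVec (typical n)
    T = (n * D) * (n * D)
    g : Vec (Fin p) n → ℕ
    g x = (t * ∣ deviation n x ∣) * (t * ∣ deviation n x ∣)
    regroup : ∀ t d → (t * d) * (t * d) ≡ t * t * (d * d)
    regroup = solve-∀
    factor-n : ∀ n δ D → n * (δ * (n * (D * D))) ≡ δ * ((n * D) * (n * D))
    factor-n = solve-∀
    factor-n′ : ∀ n t p P → t * t * (n * (p * p) * P) ≡ n * (t * t * (p * p) * P)
    factor-n′ = solve-∀
    ∑g≡t²moment : ∑ℕ g (allVecs p n) ≡ t * t * moment n
    ∑g≡t²moment = trans (ℕ-sum.∑-cong (λ x → regroup t ∣ deviation n x ∣) (allVecs p n))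
                (ℕ-sum.∑-*ˡ (t * t) (λ x → ∣ deviation n x ∣ * ∣ deviation n x ∣) (allVecs p n))
    markov-bound : P * T ≤ c * T + t * t * (n * (p * p) * P)
    markov-bound = begin
      P * T                                ≡⟨ cong (_* T) (length-allVecs p n) ⟨
      length (allVecs p n) * T             ≡⟨ ℕₚ.*-comm (length (allVecs p n)) T ⟩
      T * length (allVecs p n)             ≤⟨ markov (typical n) g T
                                                (λ x atyp → ℕₚ.*-mono-≤ (nD≤t∣deviation∣ x atyp)
                                                                        (nD≤t∣deviation∣ x atyp))
                                                (allVecs p n) ⟩
      T * c + ∑ℕ g (allVecs p n)           ≡⟨ cong₂ _+_ (ℕₚ.*-comm T c) ∑g≡t²moment ⟩
      c * T + t * t * moment n             ≤⟨ ℕₚ.+-monoʳ-≤ (c * T) (ℕₚ.*-monoʳ-≤ (t * t) (moment≤ n)) ⟩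
      c * T + t * t * (n * (p * p) * P)    ∎

  density-typical : ∀ n .{{_ : NonZero p}} .{{_ : NonZero n}} .{{_ : NonZero D}} (ε : ℚ.ℚ) → ℚ.0ℚ ℚ.< ε →
    t * t * (p * p) * ℚ.↧ₙ ε < n → ℚ.∣ ℚ.1ℚ ℚ.- densityVec (typical n) ∣ ℚ.< ε
  density-typical n ε 0<ε large =
    ∣1-c/P∣<ε (cardVec (typical n)) (p ^ n) {{ℕₚ.m^n≢0 p n}} (cardVec≤ (typical n)) ε 0<ε
      (deficit*k< (p ^ n) (cardVec (typical n)) n D (t * t * (p * p)) (ℚ.↧ₙ ε) {{ℕₚ.m^n≢0 p n}}
                  (atypical-deficit n) large)

module Pigeonhole where

  open import Data.Bool using (true; false)
  open import Data.Nat
  open import Data.Nat.Tactic.RingSolver using (solve-∀)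
  open import Data.Vec using (countᵇ)
  open import Data.Vec.Relation.Unary.All using (All; []; _∷_)
  open import Relation.Binary.PropositionalEquality
  open Counting

  All-tensor⇒countᵇ+countᵇ≤ : ∀ {p q r} (f : Fin p → Fin q → Fin r) (Z₀ : Fin r → Bool)
    (A : Fin p → Bool) (B : Fin q → Bool) → (∀ a b → A a ≡ true → B b ≡ true → Z₀ (f a b) ≡ false) →
    ∀ {n} (x : Vec (Fin p) n) (y : Vec (Fin q) n) →
    All (λ z → Z₀ z ≡ true) (tensor f x y) → countᵇ A x + countᵇ B y ≤ n
  All-tensor⇒countᵇ+countᵇ≤ f Z₀ A B avoids [] [] [] = z≤n
  All-tensor⇒countᵇ+countᵇ≤ f Z₀ A B avoids (a ∷ x) (b ∷ y) (Z₀fab ∷ all)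
    rewrite countᵇ-∷ A a x | countᵇ-∷ B b y
    with IH ← All-tensor⇒countᵇ+countᵇ≤ f Z₀ A B avoids x y all | A a in Aa | B b in Bb
  ... | true  | true  with () ← trans (sym Z₀fab) (avoids a b Aa Bb)
  ... | true  | false = s≤s IH
  ... | false | true  = ℕₚ.≤-trans (ℕₚ.≤-reflexive (ℕₚ.+-suc (countᵇ A x) (countᵇ B y))) (s≤s IH)
  ... | false | false = ℕₚ.m≤n⇒m≤1+n IH

  counts-exceed : ∀ n a b p q D K L → p * q + D ≡ a * q + b * p →
    2 * q * (n * a) < 2 * q * (p * K) + n * D → 2 * p * (n * b) < 2 * p * (q * L) + n * D →
    n < K + L
  counts-exceed n a b p q D K L pq+D≡aq+bp A-typical B-typical =
    ℕₚ.*-cancelˡ-< (2 * (p * q)) n (K + L) (ℕₚ.+-cancelʳ-< (2 * (n * D)) _ _ (begin-strict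
      2 * (p * q) * n + 2 * (n * D)                         ≡⟨ expand-lhs n p q D ⟨
      2 * n * (p * q + D)                                   ≡⟨ cong (2 * n *_) pq+D≡aq+bp ⟩
      2 * n * (a * q + b * p)                               ≡⟨ expand-n n a b p q ⟨
      2 * q * (n * a) + 2 * p * (n * b)                     <⟨ ℕₚ.+-mono-< A-typical B-typical ⟩
      2 * q * (p * K) + n * D + (2 * p * (q * L) + n * D)   ≡⟨ expand-rhs n p q D K L ⟩
      2 * (p * q) * (K + L) + 2 * (n * D)                   ∎))
    where
    open ℕₚ.≤-Reasoning
    expand-n : ∀ n a b p q → 2 * q * (n * a) + 2 * p * (n * b) ≡ 2 * n * (a * q + b * p)
    expand-n = solve-∀
    expand-lhs : ∀ n p q D → 2 * n * (p * q + D) ≡ 2 * (p * q) * n + 2 * (n * D)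
    expand-lhs = solve-∀
    expand-rhs : ∀ n p q D K L →
      2 * q * (p * K) + n * D + (2 * p * (q * L) + n * D) ≡ 2 * (p * q) * (K + L) + 2 * (n * D)
    expand-rhs = solve-∀

open import Data.Nat using (ℕ; NonZero) renaming (_≤_ to _≤ℕ_)
open import Data.Bool using (Bool; true; false)
open import Data.Fin using (Fin)
open import Data.Vec using (Vec)
open import Data.Vec.Relation.Unary.All using (All)
open import Data.Product using (Σ; ∃; _×_)
open import Data.Rational using (ℚ; 0ℚ; 1ℚ; _+_; _-_; _<_; _⊓_; ∣_∣)
open import Relation.Binary.PropositionalEquality using (_≡_)
open import Relation.Nullary using (¬_)

open import Data.Product using (_,_)
open import Relation.Binary.PropositionalEquality using (trans)
import Data.Nat as ℕ
import Data.Rational as ℚ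
open RationalBounds
open Pigeonhole

proposition4p2 : (p q r : ℕ) → .{{_ : NonZero p}} → .{{_ : NonZero q}} →
    (f : Fin p → Fin q → Fin r) → (Z₀ : Fin r → Bool) →
    (Σ (Fin p → Bool) λ A → Σ (Fin q → Bool) λ B →
      (∀ a b → A a ≡ true → B b ≡ true → Z₀ (f a b) ≡ false) ×
      (1ℚ < densityFin A + densityFin B)) →
    Σ ((n : ℕ) → Vec (Fin p) n → Bool) λ E →
    Σ ((n : ℕ) → Vec (Fin q) n → Bool) λ F →
      (∀ n (x : Vec (Fin p) n) (y : Vec (Fin q) n) →
        E n x ≡ true → F n y ≡ true → ¬ All (λ z → Z₀ z ≡ true) (tensor f x y)) ×
      (∀ (ε : ℚ) → 0ℚ < ε → ∃ λ N → ∀ n → N ≤ℕ n →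
        ∣ 1ℚ - (densityVec (E n) ⊓ densityVec (F n)) ∣ < ε)
proposition4p2 p q r f Z₀ (A , B , avoids , dense) = TA.typical , TB.typical , avoids-Z₀ , densities→1
  where
  a = cardFin A
  b = cardFin B
  pq<aq+bp = 1<a/p+b/q⇒pq<aq+bp p q a b dense
  D = a ℕ.* q ℕ.+ b ℕ.* p ℕ.∸ p ℕ.* q
  instance
    D≢0 : NonZero D
    D≢0 = ℕ.>-nonZero (ℕₚ.m<n⇒0<n∸m pq<aq+bp)
  pq+D≡aq+bp : p ℕ.* q ℕ.+ D ≡ a ℕ.* q ℕ.+ b ℕ.* p
  pq+D≡aq+bp = trans (ℕₚ.+-comm (p ℕ.* q) D) (ℕₚ.m∸n+n≡m (ℕₚ.<⇒≤ pq<aq+bp))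
  module TA = Typical A (2 ℕ.* q) D
  module TB = Typical B (2 ℕ.* p) D
  avoids-Z₀ : ∀ n (x : Vec (Fin p) n) (y : Vec (Fin q) n) →
    TA.typical n x ≡ true → TB.typical n y ≡ true → ¬ All (λ z → Z₀ z ≡ true) (tensor f x y)
  avoids-Z₀ n x y Ex Fy all = ℕₚ.<⇒≱
    (counts-exceed n a b p q D _ _ pq+D≡aq+bp (TA.typical⇒ x Ex) (TB.typical⇒ y Fy))
    (All-tensor⇒countᵇ+countᵇ≤ f Z₀ A B avoids x y all)
  CA = 2 ℕ.* q ℕ.* (2 ℕ.* q) ℕ.* (p ℕ.* p)
  CB = 2 ℕ.* p ℕ.* (2 ℕ.* p) ℕ.* (q ℕ.* q)
  densities→1 : ∀ (ε : ℚ) → 0ℚ < ε → ∃ λ N → ∀ n → N ≤ℕ n →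
    ∣ 1ℚ - (densityVec (TA.typical n) ⊓ densityVec (TB.typical n)) ∣ < ε
  densities→1 ε 0<ε = ℕ.suc ((CA ℕ.+ CB) ℕ.* ℚ.↧ₙ ε) , close
    where
    close : ∀ n → ℕ.suc ((CA ℕ.+ CB) ℕ.* ℚ.↧ₙ ε) ≤ℕ n →
      ∣ 1ℚ - (densityVec (TA.typical n) ⊓ densityVec (TB.typical n)) ∣ < ε
    close n@(ℕ.suc _) (ℕ.s≤s [CA+CB]k≤m) =
      ∣1-x⊓y∣<ε (densityVec (TA.typical n)) (densityVec (TB.typical n)) ε
        (TA.density-typical n ε 0<ε (ℕ.s≤s (ℕₚ.≤-trans (ℕₚ.*-monoˡ-≤ (ℚ.↧ₙ ε) (ℕₚ.m≤m+n CA CB)) [CA+CB]k≤m)))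
        (TB.density-typical n ε 0<ε (ℕ.s≤s (ℕₚ.≤-trans (ℕₚ.*-monoˡ-≤ (ℚ.↧ₙ ε) (ℕₚ.m≤n+m CB CA)) [CA+CB]k≤m)))
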